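{- Let $G$ be a finite abelian group and $r\ge 2$ an integer. If $\eta_{r-1}(G)\le D(G)+(r-1)\exp(G)$, then $D_r(G)\le D(G)+(r-1)\exp(G)$.
   Context: Groups are written additively; $\exp(G)$ is the exponent of $G$. A sequence over $G$ is a finite multiset of elements of $G$; subsequences are sub-multisets; disjoint subsequences use distinct terms. A sequence is zero-sum if the sum of its terms is $0$; a short zero-sum sequence is a zero-sum sequence of length in $[1,\exp(G)]$. $D(G)$ is the least positive integer $k$ such that every sequence over $G$ of length at least $k$ has a nonempty zero-sum subsequence. For $s\in\mathbb{N}$, $D_s(G)$ is the least positive integer $k$ such that every sequence over $G$ of length at least $k$ contains $s$ pairwise disjoint nonempty zero-sum subsequences, and $\eta_s(G)$ is the least positive integer $k$ such that every sequence over $G$ of length at least $k$ has $s$ pairwise disjoint short zero-sum subsequences. -}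

module Defs where

open import Level using (Level; _⊔_)
open import Algebra.Bundles using (AbelianGroup)
open import Data.Nat using (ℕ; zero; suc; _≤_; _+_)
open import Data.Bool using (true; false)
open import Data.Fin using (Fin)
open import Data.Fin.Subset using (Subset; _∩_; ⊥; ∣_∣; Nonempty)
open import Data.Vec using (Vec; []; _∷_)
open import Data.Product using (Σ; ∃; _×_)
open import Relation.Binary.PropositionalEquality using (_≡_; _≢_)

module _ {c ℓ : Level} (G : AbelianGroup c ℓ) where
  open AbelianGroup G

  IsFinite : Set (c ⊔ ℓ)
  IsFinite = Σ ℕ λ n → Σ (Fin n → Carrier) λ f → ∀ x → ∃ λ i → f i ≈ x

  _·_ : ℕ → Carrier → Carrier
  zero  · g = ε
  suc n · g = g ∙ (n · g)

  sumSel : ∀ {m} → Vec Carrier m → Subset m → Carrier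
  sumSel [] [] = ε
  sumSel (x ∷ xs) (true ∷ p) = x ∙ sumSel xs p
  sumSel (x ∷ xs) (false ∷ p) = sumSel xs p

  IsLeastPos : ∀ {a} → (ℕ → Set a) → ℕ → Set a
  IsLeastPos P k = (1 ≤ k) × P k × (∀ j → 1 ≤ j → P j → k ≤ j)

  IsExp : ℕ → Set (c ⊔ ℓ)
  IsExp = IsLeastPos (λ n → ∀ g → (n · g) ≈ ε)

  ZeroSumSub : ∀ {m} → Vec Carrier m → Subset m → Set ℓ
  ZeroSumSub xs p = Nonempty p × (sumSel xs p ≈ ε)

  ShortZeroSumSub : ℕ → ∀ {m} → Vec Carrier m → Subset m → Set ℓ
  ShortZeroSumSub e xs p = ZeroSumSub xs p × (∣ p ∣ ≤ e)

  HasDisjoint : ∀ {m} → ℕ → (Subset m → Set ℓ) → Set ℓ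
  HasDisjoint {m} s Q = Σ (Fin s → Subset m) λ A →
    (∀ i → Q (A i)) × (∀ i j → i ≢ j → (A i ∩ A j) ≡ ⊥)

  EverySeqFrom : (∀ {m} → Vec Carrier m → Set ℓ) → ℕ → Set (c ⊔ ℓ)
  EverySeqFrom Q k = ∀ m → k ≤ m → (xs : Vec Carrier m) → Q xs

  IsDav : ℕ → Set (c ⊔ ℓ)
  IsDav = IsLeastPos (EverySeqFrom (λ xs → ∃ λ p → ZeroSumSub xs p))

  IsDs : ℕ → ℕ → Set (c ⊔ ℓ)
  IsDs s = IsLeastPos (EverySeqFrom (λ xs → HasDisjoint s (ZeroSumSub xs)))

  IsEta : ℕ → ℕ → ℕ → Set (c ⊔ ℓ)
  IsEta e s = IsLeastPos (EverySeqFrom (λ xs → HasDisjoint s (ShortZeroSumSub e xs)))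

{-# OPTIONS --safe #-}
-- Let S be a sequence of length at least D(G) + (r-1) exp(G) ≥ η_{r-1}(G).  It contains
-- r-1 disjoint short zero-sum subsequences; together they use at most (r-1) exp(G) terms,
-- so the remaining terms still number at least D(G) and contain one more zero-sum
-- subsequence, disjoint from the others.
module Submission where

open import Defs
open import Level using (Level)
open import Algebra.Bundles using (AbelianGroup)
open import Data.Nat using (ℕ; suc; _≤_; _+_; _*_; _∸_; z≤n; s≤s)
open import Data.Nat.Properties
  using (≤-trans; ≤-reflexive; +-mono-≤; +-monoʳ-≤; +-suc; m≤m+n; m+n≤o⇒m≤o∸n)
open import Data.Bool using (true; false)
open import Data.Fin using (Fin)
import Data.Fin as Fin
open import Data.Fin.Subset
  using (Subset; _∩_; _∪_; ⊥; ∁; ⋃; ∣_∣; Nonempty; _⊆_)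
open import Data.Fin.Subset.Properties
  using (p⊆p∪q; q⊆p∪q; ⊆-trans; ∩-comm; x∈p∩q⁻; x∈∁p⇒x∉p; Empty-unique;
         ∣⊥∣≡0; ∣p∣≤∣x∷p∣; ∣∁p∣≡n∸∣p∣)
open import Data.List using (List; []; _∷_; length; tabulate)
open import Data.List.Properties using (length-tabulate)
open import Data.List.Relation.Unary.All using (All; []; _∷_)
open import Data.List.Relation.Unary.All.Properties using (tabulate⁺)
import Data.List.Relation.Unary.Any as Any
import Data.List.Membership.Propositional as List
open import Data.List.Membership.Propositional.Properties using (∈-tabulate⁺)
open import Data.Vec using (Vec; []; _∷_; here; there)
open import Data.Vec.Functional using () renaming (_∷_ to _∷ᶠ_)
open import Data.Product using (∃; _×_; _,_; proj₁; proj₂)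
open import Relation.Binary.PropositionalEquality using (_≡_; _≢_; refl; sym; cong; subst; trans)
open import Relation.Nullary using (contradiction)
open import Function using (_∘_)

private
  variable
    m n : ℕ

∣p∪q∣≤∣p∣+∣q∣ : (p q : Subset n) → ∣ p ∪ q ∣ ≤ ∣ p ∣ + ∣ q ∣
∣p∪q∣≤∣p∣+∣q∣ []          []          = z≤n
∣p∪q∣≤∣p∣+∣q∣ (true ∷ p)  (b ∷ q)     =
  s≤s (≤-trans (∣p∪q∣≤∣p∣+∣q∣ p q) (+-monoʳ-≤ ∣ p ∣ (∣p∣≤∣x∷p∣ b q)))
∣p∪q∣≤∣p∣+∣q∣ (false ∷ p) (true ∷ q)  =
  subst (suc ∣ p ∪ q ∣ ≤_) (sym (+-suc ∣ p ∣ ∣ q ∣)) (s≤s (∣p∪q∣≤∣p∣+∣q∣ p q))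
∣p∪q∣≤∣p∣+∣q∣ (false ∷ p) (false ∷ q) = ∣p∪q∣≤∣p∣+∣q∣ p q

p∈ps⇒p⊆⋃ps : {p : Subset n} {ps : List (Subset n)} → p List.∈ ps → p ⊆ ⋃ ps
p∈ps⇒p⊆⋃ps {ps = p ∷ ps} (Any.here refl) = p⊆p∪q (⋃ ps)
p∈ps⇒p⊆⋃ps {ps = q ∷ ps} (Any.there p∈ps) = ⊆-trans (p∈ps⇒p⊆⋃ps p∈ps) (q⊆p∪q q (⋃ ps))

∣⋃ps∣≤length*bound : {e : ℕ} (ps : List (Subset n)) →
                     All (λ p → ∣ p ∣ ≤ e) ps → ∣ ⋃ ps ∣ ≤ length ps * e
∣⋃ps∣≤length*bound {n} []       []          = ≤-reflexive (∣⊥∣≡0 n)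
∣⋃ps∣≤length*bound     (p ∷ ps) (∣p∣≤e ∷ h) =
  ≤-trans (∣p∪q∣≤∣p∣+∣q∣ p (⋃ ps)) (+-mono-≤ ∣p∣≤e (∣⋃ps∣≤length*bound ps h))

⊆∁-disjoint : {p q u : Subset n} → p ⊆ ∁ u → q ⊆ u → p ∩ q ≡ ⊥
⊆∁-disjoint {p = p} {q} p⊆∁u q⊆u = Empty-unique λ (x , x∈p∩q) →
  let (x∈p , x∈q) = x∈p∩q⁻ p q x∈p∩q in x∈∁p⇒x∉p (p⊆∁u x∈p) (q⊆u x∈q)

-- embed p q is the set of positions of xs occupied by the subsequence q of select xs p.
select : ∀ {a} {A : Set a} → Vec A n → (p : Subset n) → Vec A ∣ p ∣
select []       []          = []
select (x ∷ xs) (true ∷ p)  = x ∷ select xs p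
select (x ∷ xs) (false ∷ p) = select xs p

embed : (p : Subset n) → Subset ∣ p ∣ → Subset n
embed []          []      = []
embed (true ∷ p)  (b ∷ q) = b ∷ embed p q
embed (false ∷ p) q       = false ∷ embed p q

embed-⊆ : (p : Subset n) (q : Subset ∣ p ∣) → embed p q ⊆ p
embed-⊆ (true ∷ p)  (true ∷ q)  here        = here
embed-⊆ (true ∷ p)  (_ ∷ q)     (there x∈)  = there (embed-⊆ p q x∈)
embed-⊆ (false ∷ p) q           (there x∈)  = there (embed-⊆ p q x∈)

embed-nonempty : (p : Subset n) (q : Subset ∣ p ∣) → Nonempty q → Nonempty (embed p q)
embed-nonempty (true ∷ p)  (true ∷ q) (Fin.zero , here) = Fin.zero , here
embed-nonempty (true ∷ p)  (_ ∷ q)    (Fin.suc x , there x∈q)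
  with y , y∈ ← embed-nonempty p q (x , x∈q) = Fin.suc y , there y∈
embed-nonempty (false ∷ p) q          q≠∅
  with y , y∈ ← embed-nonempty p q q≠∅ = Fin.suc y , there y∈

HasDisjoint-cons : ∀ {c ℓ} (G : AbelianGroup c ℓ) {s} {Q : Subset m → Set ℓ}
                   (p : Subset m) (A : Fin s → Subset m) →
                   Q p → (∀ i → p ∩ A i ≡ ⊥) →
                   (∀ i → Q (A i)) → (∀ i j → i ≢ j → A i ∩ A j ≡ ⊥) →
                   HasDisjoint G (suc s) Q
HasDisjoint-cons G {Q = Q} p A Qp p∩A≡⊥ QA A-disjoint = p ∷ᶠ A , Q-cons , disjoint-cons
  where
  Q-cons : ∀ i → Q ((p ∷ᶠ A) i)
  Q-cons Fin.zero    = Qp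
  Q-cons (Fin.suc i) = QA i

  disjoint-cons : ∀ i j → i ≢ j → (p ∷ᶠ A) i ∩ (p ∷ᶠ A) j ≡ ⊥
  disjoint-cons Fin.zero    Fin.zero    i≢j = contradiction refl i≢j
  disjoint-cons Fin.zero    (Fin.suc j) _   = p∩A≡⊥ j
  disjoint-cons (Fin.suc i) Fin.zero    _   = trans (∩-comm (A i) p) (p∩A≡⊥ i)
  disjoint-cons (Fin.suc i) (Fin.suc j) i≢j = A-disjoint i j (λ i≡j → i≢j (cong Fin.suc i≡j))

module _ {c ℓ : Level} (G : AbelianGroup c ℓ) where
  open AbelianGroup G using (Carrier; _∙_; _≈_; ε)

  sumSel-embed : (xs : Vec Carrier n) (p : Subset n) (q : Subset ∣ p ∣) →
                 sumSel G xs (embed p q) ≡ sumSel G (select xs p) q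
  sumSel-embed []       []          []          = refl
  sumSel-embed (x ∷ xs) (true ∷ p)  (true ∷ q)  = cong (x ∙_) (sumSel-embed xs p q)
  sumSel-embed (x ∷ xs) (true ∷ p)  (false ∷ q) = sumSel-embed xs p q
  sumSel-embed (x ∷ xs) (false ∷ p) q           = sumSel-embed xs p q

  zeroSumSub-outside : {d : ℕ} → EverySeqFrom G (λ xs → ∃ (ZeroSumSub G xs)) d →
                       (xs : Vec Carrier m) (u : Subset m) → d + ∣ u ∣ ≤ m →
                       ∃ λ p → ZeroSumSub G xs p × p ⊆ ∁ u
  zeroSumSub-outside {d = d} davenport xs u d+∣u∣≤m =
    embedded (davenport ∣ ∁ u ∣ d≤∣∁u∣ (select xs (∁ u)))
    where
    d≤∣∁u∣ : d ≤ ∣ ∁ u ∣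
    d≤∣∁u∣ = subst (d ≤_) (sym (∣∁p∣≡n∸∣p∣ u)) (m+n≤o⇒m≤o∸n d d+∣u∣≤m)

    embedded : ∃ (ZeroSumSub G (select xs (∁ u))) → ∃ λ p → ZeroSumSub G xs p × p ⊆ ∁ u
    embedded (q , q≠∅ , Σq≈ε) =
      embed (∁ u) q ,
      (embed-nonempty (∁ u) q q≠∅ , subst (_≈ ε) (sym (sumSel-embed xs (∁ u) q)) Σq≈ε) ,
      embed-⊆ (∁ u) q

  oneMoreDisjointZeroSum :
    {d e η s : ℕ} →
    EverySeqFrom G (λ xs → ∃ (ZeroSumSub G xs)) d →
    EverySeqFrom G (λ xs → HasDisjoint G s (ShortZeroSumSub G e xs)) η →
    η ≤ d + s * e →
    EverySeqFrom G (λ xs → HasDisjoint G (suc s) (ZeroSumSub G xs)) (d + s * e)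
  oneMoreDisjointZeroSum {d} {e} {s = s} davenport eta η≤d+s*e m d+s*e≤m xs =
    extend (eta m (≤-trans η≤d+s*e d+s*e≤m) xs)
    where
    extend : HasDisjoint G s (ShortZeroSumSub G e xs) → HasDisjoint G (suc s) (ZeroSumSub G xs)
    extend (A , A-short , A-disjoint) =
      add (zeroSumSub-outside davenport xs U (≤-trans (+-monoʳ-≤ d ∣U∣≤s*e) d+s*e≤m))
      where
      U : Subset m
      U = ⋃ (tabulate A)

      ∣U∣≤s*e : ∣ U ∣ ≤ s * e
      ∣U∣≤s*e = subst (λ k → ∣ U ∣ ≤ k * e) (length-tabulate A)
        (∣⋃ps∣≤length*bound (tabulate A) (tabulate⁺ (proj₂ ∘ A-short)))

      add : (∃ λ p → ZeroSumSub G xs p × p ⊆ ∁ U) → HasDisjoint G (suc s) (ZeroSumSub G xs)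
      add (p , p-zeroSum , p⊆∁U) =
        HasDisjoint-cons G p A p-zeroSum
          (λ i → ⊆∁-disjoint p⊆∁U (p∈ps⇒p⊆⋃ps (∈-tabulate⁺ i)))
          (proj₁ ∘ A-short) A-disjoint

lemma12 : {c ℓ : Level} (G : AbelianGroup c ℓ) → IsFinite G →
    (r : ℕ) → 2 ≤ r →
    (d e η Dr : ℕ) → IsDav G d → IsExp G e → IsEta G e (r ∸ 1) η → IsDs G r Dr →
    η ≤ d + (r ∸ 1) * e →
    Dr ≤ d + (r ∸ 1) * e
lemma12 G _ (suc s) (s≤s _) d e η Dr (1≤d , davenport , _) _ (_ , eta , _) (_ , _ , Dr-least) η≤ =
  Dr-least (d + s * e) (≤-trans 1≤d (m≤m+n d (s * e)))
    (oneMoreDisjointZeroSum G davenport eta η≤)
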